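{- Let $k$ be a natural number and let $p$ be the smallest prime with $p > 2^{k-1}+1$. Then for every odd $q$, the graph $G_{q,2^{k-1}}$ is not $\mathbb{Z}_2^k$-connected. Moreover, $G_{q,2^{k-1}}$ is $\mathbb{Z}_p$-connected whenever $q\ge p$.
   Context: Graphs may have multiple edges but no loops. For natural numbers $q,m$, $G_{q,m}$ denotes the graph consisting of two vertices $s,t$ joined by $q$ internally disjoint paths, each of length $m$. For a directed graph and a vertex $v$, $E^+(v)$ and $E^-(v)$ denote the sets of edges leaving and entering $v$. For an Abelian group $\Gamma$, a graph $G$ is $\Gamma$-connected if, for some orientation of $G$ (equivalently, for every orientation), and for every function $\beta: V(G)\to\Gamma$ with $\sum_{v\in V(G)}\beta(v)=0$, there is a function $f:E(G)\to\Gamma$ with $f(e)\neq 0$ for all edges $e$ and $\sum_{e\in E^+(v)}f(e)-\sum_{e\in E^-(v)}f(e)=\beta(v)$ for all $v\in V(G)$. -}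

module Defs where

open import Data.Nat using (ℕ; zero; suc; _+_; _*_; _∸_; NonZero)
open import Data.Nat.DivMod using (_mod_)
open import Data.Bool using (Bool; true; false; if_then_else_; _xor_)
open import Data.Fin using (Fin; toℕ; _≟_)
open import Data.Vec using (Vec; zipWith; replicate)
import Data.List as L
open import Data.Product using (Σ; _×_; _,_; proj₁; proj₂)
open import Relation.Nullary using (¬_; does)
open import Relation.Binary.PropositionalEquality using (_≡_)

-- An Abelian group given by its operations (equality is propositional ≡).
-- Only concrete groups (ℤ_n and ℤ_2^k) are instantiated below.
record GroupOps : Set₁ where
  field
    Carrier : Set
    0# : Carrier
    _⊕_ : Carrier → Carrier → Carrier
    ⊖_ : Carrier → Carrier

Zmod : (n : ℕ) .{{_ : NonZero n}} → GroupOps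
Zmod n = record
  { Carrier = Fin n
  ; 0# = 0 mod n
  ; _⊕_ = λ a b → (toℕ a + toℕ b) mod n
  ; ⊖_ = λ a → (n ∸ toℕ a) mod n
  }

Z2^ : ℕ → GroupOps
Z2^ k = record
  { Carrier = Vec Bool k
  ; 0# = replicate k false
  ; _⊕_ = zipWith _xor_
  ; ⊖_ = λ a → a
  }

-- A finite multigraph: vertices Fin n, edges indexed by Fin e,
-- each edge having two ends (the pair order is irrelevant for
-- Γ-connectivity, which quantifies over orientations).
record Multigraph : Set where
  field
    n : ℕ
    e : ℕ
    ends : Fin e → Fin n × Fin n

Loopless : Multigraph → Set
Loopless G = ∀ i → ¬ (proj₁ (Multigraph.ends G i) ≡ proj₂ (Multigraph.ends G i))

module _ (Γ : GroupOps) where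
  open GroupOps Γ

  sumFin : {m : ℕ} → (Fin m → Carrier) → Carrier
  sumFin {zero} f = 0#
  sumFin {suc m} f = f Fin.zero ⊕ sumFin (λ i → f (Fin.suc i))

  tail head : (G : Multigraph) → (Fin (Multigraph.e G) → Bool) →
              Fin (Multigraph.e G) → Fin (Multigraph.n G)
  tail G o i = if o i then proj₁ (Multigraph.ends G i) else proj₂ (Multigraph.ends G i)
  head G o i = if o i then proj₂ (Multigraph.ends G i) else proj₁ (Multigraph.ends G i)

  netOut : (G : Multigraph) → (Fin (Multigraph.e G) → Bool) →
           (Fin (Multigraph.e G) → Carrier) → Fin (Multigraph.n G) → Carrier
  netOut G o f v =
    sumFin (λ i → if does (tail G o i ≟ v) then f i else 0#) ⊕
    (⊖ sumFin (λ i → if does (head G o i ≟ v) then f i else 0#))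

  IsConnected : Multigraph → Set
  IsConnected G =
    Σ (Fin (Multigraph.e G) → Bool) λ o →
      (β : Fin (Multigraph.n G) → Carrier) → sumFin β ≡ 0# →
      Σ (Fin (Multigraph.e G) → Carrier) λ f →
        ((i : Fin (Multigraph.e G)) → ¬ (f i ≡ 0#)) ×
        ((v : Fin (Multigraph.n G)) → netOut G o f v ≡ β v)

-- G_{q,m}: vertices s = 0, t = 1, and for path i < q the internal vertex
-- number j (1 ≤ j ≤ m-1) is 2 + i*(m-1) + (j-1).  Path i has edges
-- (node i j , node i (j+1)) for j < m.
module _ (q m : ℕ) where
  private
    N : ℕ
    N = 2 + q * (m ∸ 1)

    node : ℕ → ℕ → ℕ
    node i zero = 0
    node i (suc j) = if does (Data.Nat._≟_ (suc j) m) then 1 else 2 + i * (m ∸ 1) + j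

    edgeList : L.List (Fin N × Fin N)
    edgeList = L.concatMap (λ i → L.map (λ j → (node i j mod N , node i (suc j) mod N))
                                        (L.upTo m))
                           (L.upTo q)

  G : Multigraph
  G = record { n = N ; e = L.length edgeList ; ends = L.lookup edgeList }

-- Orient every path of G_{q,m} from s to t, so that a boundary condition at the inner vertices of a
-- path fixes the flow on that path up to one free value x_i per path.
--
-- Over ℤ₂ᵏ with m = 2^(k-1), choose β(s) = 0 and, at the j-th inner vertex of each path, β = c_j + c_(j+1),
-- where c_0, …, c_(m-1) run through all elements with first coordinate 0. Every solution has
-- f(e_(i,j)) = x_i + c_j, so nowhere-zero forces the first coordinate of each x_i to be 1, and the first
-- coordinate of the outflow Σ_i f(e_(i,0)) = β(s) = 0 is q mod 2: q must be even.
--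
-- Over ℤₚ with p ≥ m + 2 and q ≥ p, take f(e_(i,j)) = x_i + (sum of β over the first j inner vertices of
-- path i). Each x_i must avoid m values, leaving two candidates a_i ≠ a′_i, and Σ_i x_i must equal β(s)
-- (then t balances because Σβ = 0). The q nonzero differences a′_i − a_i have every element of ℤₚ as a
-- subset sum, since adding {0, d} with d ≠ 0 to a proper subset of ℤₚ enlarges it (d generates ℤₚ).

module Submission where

open import Defs
open import Data.Nat using (ℕ; _+_; _∸_; _^_; _≤_; _<_)
open import Data.Nat.Divisibility using (_∣_)
open import Data.Nat.Primality using (Prime; prime⇒nonZero)
open import Data.Product using (_×_)
open import Relation.Nullary using (¬_)

open import Level using (0ℓ)
open import Algebra.Bundles using (AbelianGroup)
import Algebra.Structures as Structures
open import Data.Nat as ℕ using (zero; suc; _*_; NonZero; ≢-nonZero; >-nonZero⁻¹; s≤s)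
open import Data.Nat.Properties
  using ( +-assoc; +-comm; *-comm; *-assoc; m∸n+n≡m; <⇒≤; <⇒≢; m^n>0
        ; ≤-trans; <-trans; n<1+n; n≤1+n; ≤-antisym; ≤-reflexive)
open import Data.Nat.DivMod using (_%_; _mod_; %-distribˡ-+; m%n%n≡m%n; m<n⇒m%n≡m; n%n≡0; [m+kn]%n≡m%n)
open import Data.Nat.Divisibility using (divides; ∣-refl; ∣m∣n⇒∣m+n)
open import Data.Nat.Coprimality using (prime⇒coprime; coprime-Bézout)
open import Data.Nat.GCD using (module Bézout)
open import Data.Nat.Tactic.RingSolver using (solve-∀)
open import Data.Bool using (Bool; true; false; not; if_then_else_; _xor_)
open import Data.Bool.Properties using (xor-assoc; xor-comm; xor-same; not-involutive)
open import Data.Fin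
  using (Fin; zero; suc; toℕ; _≟_; punchIn; _↑ˡ_; _↑ʳ_; combine; remQuot; inject₁; cast; finToFun; funToFin)
open import Data.Fin.Properties
  using ( toℕ-injective; toℕ-fromℕ<; toℕ<n; toℕ-combine; toℕ-inject₁; toℕ-fromℕ; suc-injective
        ; cast-involutive; punchInᵢ≢i; remQuot-combine; combine-remQuot; combine-injectiveˡ; combine-injectiveʳ
        ; finToFun-funToFin; 2↔Bool; all?; any?; ¬∀⟶∃¬; pigeonhole)
open import Data.Fin.Induction using (<-weakInduction)
open import Data.Fin.Relation.Unary.Top using (view; ‵fromℕ; ‵inj₁; view-inject₁)
open import Data.Fin.Subset using (Subset; _∈_; _∉_; _⊂_; _∪_; ⁅_⁆; ∣_∣)
open import Data.Fin.Subset.Properties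
  using ( _∈?_; x∈p∪q⁺; x∈p∪q⁻; p⊆p∪q; p⊂q⇒∣p∣<∣q∣; ∣p∣≤n; ∣p∣≡n⇒p≡⊤
        ; ∈⊤; x∈⁅x⁆; x∈⁅y⁆⇒x≡y; ∣⁅x⁆∣≡1)
open import Data.Vec as Vec using (Vec; []; _∷_)
open import Data.Vec.Properties using (tabulate-cong; tabulate∘lookup; lookup∘tabulate; []=⇒lookup; lookup⇒[]=)
open import Data.Vec.Relation.Binary.Pointwise.Inductive
  using (Pointwise-≡⇒≡; zipWith-assoc; zipWith-comm; zipWith-identityˡ)
import Data.Vec.Functional as Vector
import Data.Fin.Properties as Finₚ
import Data.List as List
import Data.List.Properties as Listₚ
open import Data.Product using (∃; ∃₂; _,_; proj₁; proj₂; map₂)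
open import Data.Sum using (_⊎_; inj₁; inj₂)
open import Data.Empty using (⊥-elim)
open import Function using (_∘_; _↔_; Inverse; mk↔ₛ′)
open import Function.Construct.Symmetry using (↔-sym)
open import Relation.Nullary using (Dec; yes; no; does)
open import Relation.Nullary.Decidable using (dec-true; dec-false; _→-dec_)
open import Relation.Binary.PropositionalEquality

IsAbelian : GroupOps → Set
IsAbelian Γ = IsAbelianGroup _⊕_ 0# ⊖_
  where open GroupOps Γ
        open Structures {A = Carrier} _≡_

module _ {Γ : GroupOps} where
  open GroupOps Γ
  open Structures {A = Carrier} _≡_

  isAbelianˡ : (∀ a b c → (a ⊕ b) ⊕ c ≡ a ⊕ (b ⊕ c)) → (∀ a b → a ⊕ b ≡ b ⊕ a) →
               (∀ a → 0# ⊕ a ≡ a) → (∀ a → (⊖ a) ⊕ a ≡ 0#) → IsAbelian Γ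
  isAbelianˡ assoc comm idˡ invˡ = record
    { isGroup = record
      { isMonoid = record
        { isSemigroup = record { isMagma = record { isEquivalence = isEquivalence ; ∙-cong = cong₂ _⊕_ } ; assoc = assoc }
        ; identity = idˡ , λ a → trans (comm a 0#) (idˡ a) }
      ; inverse = invˡ , λ a → trans (comm a (⊖ a)) (invˡ a)
      ; ⁻¹-cong = cong ⊖_ }
    ; comm = comm }

asAbelianGroup : (Γ : GroupOps) → IsAbelian Γ → AbelianGroup 0ℓ 0ℓ
asAbelianGroup Γ isAb = record { isAbelianGroup = isAb }

module ℤmod-arithmetic (n : ℕ) .{{_ : NonZero n}} where
  open GroupOps (Zmod n)

  toℕ-mod : ∀ x → toℕ (x mod n) ≡ x % n
  toℕ-mod x = toℕ-fromℕ< _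

  mod-cong : ∀ x y → x % n ≡ y % n → x mod n ≡ y mod n
  mod-cong x y eq = toℕ-injective (trans (toℕ-mod x) (trans eq (sym (toℕ-mod y))))

  %-absorbˡ : ∀ x y → (x % n + y) % n ≡ (x + y) % n
  %-absorbˡ x y = begin
    (x % n + y) % n           ≡⟨ %-distribˡ-+ (x % n) y n ⟩
    (x % n % n + y % n) % n   ≡⟨ cong (λ r → (r + y % n) % n) (m%n%n≡m%n x n) ⟩
    (x % n + y % n) % n       ≡⟨ %-distribˡ-+ x y n ⟨
    (x + y) % n               ∎
    where open ≡-Reasoning

  %-absorbʳ : ∀ x y → (x + y % n) % n ≡ (x + y) % n
  %-absorbʳ x y = trans (cong (_% n) (+-comm x (y % n))) (trans (%-absorbˡ y x) (cong (_% n) (+-comm y x)))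

  toℕ-⊕ : ∀ a b → toℕ (a ⊕ b) ≡ (toℕ a + toℕ b) % n
  toℕ-⊕ a b = toℕ-mod (toℕ a + toℕ b)

ℤmod-isAbelian : (n : ℕ) .{{_ : NonZero n}} → IsAbelian (Zmod n)
ℤmod-isAbelian n = isAbelianˡ assoc (λ a b → cong (_mod n) (+-comm (toℕ a) (toℕ b))) idˡ invˡ
  where
  open GroupOps (Zmod n)
  open ℤmod-arithmetic n
  assoc : ∀ a b c → (a ⊕ b) ⊕ c ≡ a ⊕ (b ⊕ c)
  assoc a b c = mod-cong _ _ (begin
    (toℕ (a ⊕ b) + toℕ c) % n          ≡⟨ cong (λ r → (r + toℕ c) % n) (toℕ-⊕ a b) ⟩
    ((toℕ a + toℕ b) % n + toℕ c) % n  ≡⟨ %-absorbˡ (toℕ a + toℕ b) (toℕ c) ⟩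
    (toℕ a + toℕ b + toℕ c) % n        ≡⟨ cong (_% n) (+-assoc (toℕ a) _ _) ⟩
    (toℕ a + (toℕ b + toℕ c)) % n      ≡⟨ %-absorbʳ (toℕ a) (toℕ b + toℕ c) ⟨
    (toℕ a + (toℕ b + toℕ c) % n) % n  ≡⟨ cong (λ r → (toℕ a + r) % n) (toℕ-⊕ b c) ⟨
    (toℕ a + toℕ (b ⊕ c)) % n          ∎)
    where open ≡-Reasoning
  idˡ : ∀ a → 0# ⊕ a ≡ a
  idˡ a = toℕ-injective (begin
    toℕ (0# ⊕ a)                ≡⟨ toℕ-⊕ 0# a ⟩
    (toℕ (0 mod n) + toℕ a) % n ≡⟨ cong (λ r → (r + toℕ a) % n) (toℕ-mod 0) ⟩
    (0 % n + toℕ a) % n         ≡⟨ %-absorbˡ 0 (toℕ a) ⟩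
    toℕ a % n                   ≡⟨ m<n⇒m%n≡m (toℕ<n a) ⟩
    toℕ a                       ∎)
    where open ≡-Reasoning
  invˡ : ∀ a → (⊖ a) ⊕ a ≡ 0#
  invˡ a = mod-cong _ 0 (begin
    (toℕ (⊖ a) + toℕ a) % n       ≡⟨ cong (λ r → (r + toℕ a) % n) (toℕ-mod (n ∸ toℕ a)) ⟩
    ((n ∸ toℕ a) % n + toℕ a) % n ≡⟨ %-absorbˡ (n ∸ toℕ a) (toℕ a) ⟩
    (n ∸ toℕ a + toℕ a) % n       ≡⟨ cong (_% n) (m∸n+n≡m (<⇒≤ (toℕ<n a))) ⟩
    n % n                         ≡⟨ n%n≡0 n ⟩
    0                             ≡⟨ m<n⇒m%n≡m (>-nonZero⁻¹ n) ⟨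
    0 % n                         ∎)
    where open ≡-Reasoning

ℤ₂^-self : ∀ {k} (a : Vec Bool k) → GroupOps._⊕_ (Z2^ k) a a ≡ GroupOps.0# (Z2^ k)
ℤ₂^-self [] = refl
ℤ₂^-self (x ∷ a) = cong₂ _∷_ (xor-same x) (ℤ₂^-self a)

ℤ₂^-isAbelian : (k : ℕ) → IsAbelian (Z2^ k)
ℤ₂^-isAbelian k = isAbelianˡ
  (λ a b c → Pointwise-≡⇒≡ (zipWith-assoc xor-assoc a b c))
  (λ a b → Pointwise-≡⇒≡ (zipWith-comm xor-comm a b))
  (λ a → Pointwise-≡⇒≡ (zipWith-identityˡ (λ _ → refl) a))
  ℤ₂^-self

graph : {n e : ℕ} → (Fin e → Fin n × Fin n) → Multigraph
graph {n} {e} ends = record { n = n ; e = e ; ends = ends }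

module Flows (Γ : GroupOps) (isAb : IsAbelian Γ) where
  open GroupOps Γ renaming (_⊕_ to infixl 6 _⊕_; ⊖_ to infix 8 ⊖_)
  open AbelianGroup (asAbelianGroup Γ isAb)
    using (commutativeMonoid; group; assoc; comm; identityˡ; identityʳ; inverseʳ)
  open import Algebra.Properties.CommutativeMonoid.Sum commutativeMonoid public
    using (sum; ∑-distrib-+; ∑-comm; sum-cong-≗; sum-remove; sum-permute; sum-replicate-zero)
  open import Algebra.Properties.Group group using (∙-cancelʳ; ε⁻¹≈ε; ⁻¹-anti-homo-∙)

  sumFin≡sum : ∀ {n} (f : Fin n → Carrier) → sumFin Γ f ≡ sum f
  sumFin≡sum {zero} f = refl
  sumFin≡sum {suc n} f = cong (f zero ⊕_) (sumFin≡sum (f ∘ suc))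

  sum-⊖ : ∀ {n} (f : Fin n → Carrier) → sum (⊖_ ∘ f) ≡ ⊖ sum f
  sum-⊖ {zero} f = sym ε⁻¹≈ε
  sum-⊖ {suc n} f = begin
    ⊖ f zero ⊕ sum (⊖_ ∘ f ∘ suc) ≡⟨ cong (⊖ f zero ⊕_) (sum-⊖ (f ∘ suc)) ⟩
    ⊖ f zero ⊕ ⊖ sum (f ∘ suc)    ≡⟨ comm _ _ ⟩
    ⊖ sum (f ∘ suc) ⊕ ⊖ f zero    ≡⟨ ⁻¹-anti-homo-∙ _ _ ⟨
    ⊖ sum f                               ∎
    where open ≡-Reasoning

  sum-single : ∀ {n} (g : Fin n → Carrier) (x : Fin n) → (∀ y → y ≢ x → g y ≡ 0#) → sum g ≡ g x
  sum-single {suc n} g x off = begin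
    sum g                                ≡⟨ sum-remove g ⟩
    g x ⊕ sum (g ∘ punchIn x)            ≡⟨ cong (g x ⊕_) (sum-cong-≗ (λ y → off _ (punchInᵢ≢i x y))) ⟩
    g x ⊕ sum {n} (λ _ → 0#)             ≡⟨ cong (g x ⊕_) (sum-replicate-zero n) ⟩
    g x ⊕ 0#                             ≡⟨ identityʳ _ ⟩
    g x                                  ∎
    where open ≡-Reasoning

  sum-↑ : ∀ {m n} (g : Fin (m + n) → Carrier) → sum g ≡ sum (g ∘ (_↑ˡ n)) ⊕ sum (g ∘ (m ↑ʳ_))
  sum-↑ {zero} g = sym (identityˡ (sum g))
  sum-↑ {suc m} {n} g = trans (cong (g zero ⊕_) (sum-↑ {m} {n} (g ∘ suc))) (sym (assoc _ _ _))

  sum-combine : ∀ {m n} (g : Fin (m * n) → Carrier) →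
                sum g ≡ sum (λ (i : Fin m) → sum (λ (j : Fin n) → g (combine i j)))
  sum-combine {zero} g = refl
  sum-combine {suc m} {n} g =
    trans (sum-↑ {n} {m * n} g)
          (cong (sum (λ j → g (combine {suc m} {n} zero j)) ⊕_) (sum-combine {m} {n} (g ∘ (n ↑ʳ_))))

  prefixSum : ∀ {n} → (Fin n → Carrier) → Fin (suc n) → Carrier
  prefixSum b zero = 0#
  prefixSum {suc n} b (suc j) = b zero ⊕ prefixSum (b ∘ suc) j

  prefixSum-suc : ∀ {n} (b : Fin n → Carrier) j → prefixSum b (suc j) ≡ prefixSum b (inject₁ j) ⊕ b j
  prefixSum-suc {suc n} b zero = trans (identityʳ _) (sym (identityˡ _))
  prefixSum-suc {suc n} b (suc j) = trans (cong (b zero ⊕_) (prefixSum-suc (b ∘ suc) j)) (sym (assoc _ _ _))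

  δ : {n : ℕ} → Fin n → Fin n → Carrier → Carrier
  δ x v a = if does (x ≟ v) then a else 0#

  δ-off : ∀ {n} {x v : Fin n} a → x ≢ v → δ x v a ≡ 0#
  δ-off {x = x} {v} a x≢v with x ≟ v
  ... | yes x≡v = ⊥-elim (x≢v x≡v)
  ... | no _ = refl

  δ-on : ∀ {n} (x : Fin n) a → δ x x a ≡ a
  δ-on x a with x ≟ x
  ... | yes _ = refl
  ... | no x≢x = ⊥-elim (x≢x refl)

  sum-δ-unique : ∀ {n e} (a : Fin e → Fin n) v (f : Fin e → Carrier) e₀ →
                 a e₀ ≡ v → (∀ x → a x ≡ v → x ≡ e₀) → sum (λ x → δ (a x) v (f x)) ≡ f e₀
  sum-δ-unique a v f e₀ refl unique =
    trans (sum-single _ e₀ (λ x x≢e₀ → δ-off (f x) (x≢e₀ ∘ unique x))) (δ-on (a e₀) (f e₀))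

  sum-δ-none : ∀ {n e} (a : Fin e → Fin n) v (f : Fin e → Carrier) →
               (∀ x → a x ≢ v) → sum (λ x → δ (a x) v (f x)) ≡ 0#
  sum-δ-none {e = e} a v f miss = trans (sum-cong-≗ (λ x → δ-off (f x) (miss x))) (sum-replicate-zero e)

  sum-δ-at : ∀ {n} (x : Fin n) a → sum (λ v → δ x v a) ≡ a
  sum-δ-at x a = trans (sum-single _ x (λ v v≢x → δ-off a (v≢x ∘ sym))) (δ-on x a)

  module _ (G : Multigraph) where
    open Multigraph G

    netOut≡ : ∀ o f v → netOut Γ G o f v ≡
              sum (λ x → δ (tail Γ G o x) v (f x)) ⊕ ⊖ sum (λ x → δ (head Γ G o x) v (f x))
    netOut≡ o f v = cong₂ (λ s t → s ⊕ ⊖ t) (sumFin≡sum {e} _) (sumFin≡sum {e} _)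

    netOut-total : ∀ o f → sum (netOut Γ G o f) ≡ 0#
    netOut-total o f = begin
      sum (netOut Γ G o f)                  ≡⟨ sum-cong-≗ (netOut≡ o f) ⟩
      sum (λ v → out v ⊕ ⊖ into v)          ≡⟨ ∑-distrib-+ out (⊖_ ∘ into) ⟩
      sum out ⊕ sum (⊖_ ∘ into)             ≡⟨ cong (sum out ⊕_) (sum-⊖ into) ⟩
      sum out ⊕ ⊖ sum into                  ≡⟨ cong₂ (λ a b → a ⊕ ⊖ b) (sum-f (tail Γ G o)) (sum-f (head Γ G o)) ⟩
      sum f ⊕ ⊖ sum f                       ≡⟨ inverseʳ (sum f) ⟩
      0#                                    ∎
      where
      open ≡-Reasoning
      out into : Fin n → Carrier
      out v = sum (λ x → δ (tail Γ G o x) v (f x))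
      into v = sum (λ x → δ (head Γ G o x) v (f x))
      sum-f : (end : Fin e → Fin n) → sum (λ v → sum (λ x → δ (end x) v (f x))) ≡ sum f
      sum-f end = trans (∑-comm (λ v x → δ (end x) v (f x))) (sum-cong-≗ (λ x → sum-δ-at (end x) (f x)))

    netOut-orientation-irrelevant : (∀ a → ⊖ a ≡ a) → ∀ o o′ f v → netOut Γ G o f v ≡ netOut Γ G o′ f v
    netOut-orientation-irrelevant ⊖≡id o o′ f v = trans (unoriented o) (sym (unoriented o′))
      where
      ends-term : Bool → Fin e → Carrier
      ends-term b x = δ (tail Γ G (λ _ → b) x) v (f x) ⊕ δ (head Γ G (λ _ → b) x) v (f x)
      ends-term-both : (o : Fin e → Bool) (x : Fin e) → ends-term (o x) x ≡ ends-term true x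
      ends-term-both o x with o x
      ... | true = refl
      ... | false = comm _ _
      unoriented : (o : Fin e → Bool) → netOut Γ G o f v ≡ sum (ends-term true)
      unoriented o = begin
        netOut Γ G o f v                                              ≡⟨ netOut≡ o f v ⟩
        sum (λ x → δ (tail Γ G o x) v (f x)) ⊕ ⊖ sum (λ x → δ (head Γ G o x) v (f x))
          ≡⟨ cong (sum (λ x → δ (tail Γ G o x) v (f x)) ⊕_) (⊖≡id _) ⟩
        sum (λ x → δ (tail Γ G o x) v (f x)) ⊕ sum (λ x → δ (head Γ G o x) v (f x))
          ≡⟨ ∑-distrib-+ (λ x → δ (tail Γ G o x) v (f x)) _ ⟨
        sum (λ x → ends-term (o x) x)                                 ≡⟨ sum-cong-≗ (ends-term-both o) ⟩
        sum (ends-term true)                                          ∎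
        where open ≡-Reasoning

  agree-at-from-sum : ∀ {n} (X Y : Fin n → Carrier) w → sum X ≡ sum Y →
                      (∀ v → v ≢ w → X v ≡ Y v) → X w ≡ Y w
  agree-at-from-sum {suc n} X Y w ΣX≡ΣY agree = ∙-cancelʳ (sum (X ∘ punchIn w)) (X w) (Y w) (begin
    X w ⊕ sum (X ∘ punchIn w)  ≡⟨ sum-remove X ⟨
    sum X                      ≡⟨ ΣX≡ΣY ⟩
    sum Y                      ≡⟨ sum-remove Y ⟩
    Y w ⊕ sum (Y ∘ punchIn w)  ≡⟨ cong (Y w ⊕_) (sum-cong-≗ (λ v → agree _ (punchInᵢ≢i w v)) ) ⟨
    Y w ⊕ sum (X ∘ punchIn w)  ∎)
    where open ≡-Reasoning

  module _ {n e e′ : ℕ} {ends : Fin e → Fin n × Fin n} {ends′ : Fin e′ → Fin n × Fin n}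
           (π : Fin e ↔ Fin e′) (ends-π : ∀ x → ends′ (Inverse.to π x) ≡ ends x) where
    open Inverse π using (to; from; strictlyInverseʳ)

    netOut-relabel : ∀ o f v → netOut Γ (graph ends′) (o ∘ from) (f ∘ from) v ≡ netOut Γ (graph ends) o f v
    netOut-relabel o f v = begin
      netOut Γ (graph ends′) (o ∘ from) (f ∘ from) v
        ≡⟨ netOut≡ (graph ends′) (o ∘ from) (f ∘ from) v ⟩
      sum (δ-sum tail′) ⊕ ⊖ sum (δ-sum head′)
        ≡⟨ cong₂ (λ s t → s ⊕ ⊖ t) (sum-permute (δ-sum tail′) π) (sum-permute (δ-sum head′) π) ⟩
      sum (δ-sum tail′ ∘ to) ⊕ ⊖ sum (δ-sum head′ ∘ to)
        ≡⟨ cong₂ (λ a b → a ⊕ ⊖ b)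
             (sum-cong-≗ (relabelled tail′ (tail Γ (graph ends) o) (cong₂ (λ b p → if b then proj₁ p else proj₂ p))))
             (sum-cong-≗ (relabelled head′ (head Γ (graph ends) o) (cong₂ (λ b p → if b then proj₂ p else proj₁ p)))) ⟩
      sum (λ x → δ (tail Γ (graph ends) o x) v (f x)) ⊕ ⊖ sum (λ x → δ (head Γ (graph ends) o x) v (f x))
        ≡⟨ netOut≡ (graph ends) o f v ⟨
      netOut Γ (graph ends) o f v ∎
      where
      open ≡-Reasoning
      tail′ head′ : Fin e′ → Fin n
      tail′ = tail Γ (graph ends′) (o ∘ from)
      head′ = head Γ (graph ends′) (o ∘ from)
      δ-sum : (Fin e′ → Fin n) → Fin e′ → Carrier
      δ-sum end x′ = δ (end x′) v (f (from x′))
      relabelled : (end′ : Fin e′ → Fin n) (end : Fin e → Fin n) →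
                   (∀ {x} → o (from (to x)) ≡ o x → ends′ (to x) ≡ ends x → end′ (to x) ≡ end x) →
                   ∀ x → δ-sum end′ (to x) ≡ δ (end x) v (f x)
      relabelled end′ end end-eq x =
        cong₂ (λ w y → δ w v (f y)) (end-eq (cong o (strictlyInverseʳ x)) (ends-π x)) (strictlyInverseʳ x)

    relabel : IsConnected Γ (graph ends) → IsConnected Γ (graph ends′)
    relabel (o , solve) = o ∘ from , λ β Σβ≡0 →
      let (f , nowhere-zero , boundary) = solve β Σβ≡0
      in f ∘ from , nowhere-zero ∘ from , λ v → trans (netOut-relabel o f v) (boundary v)

-- Subset sums in ℤₚ

avoid : ∀ {m p} → m < p → (g : Fin m → Fin p) → ∃ λ c → ∀ j → g j ≢ c
avoid {m} {p} m<p g with all? (λ c → any? (λ j → g j ≟ c))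
... | no not-all = let (c , missed) = ¬∀⟶∃¬ p _ (λ c → any? (λ j → g j ≟ c)) not-all in
  c , λ j g-j≡c → missed (j , g-j≡c)
... | yes all-hit =
  let (c₁ , c₂ , c₁<c₂ , same-preimage) = pigeonhole m<p (proj₁ ∘ all-hit) in
  ⊥-elim (Finₚ.<⇒≢ c₁<c₂ (begin
    c₁                        ≡⟨ proj₂ (all-hit c₁) ⟨
    g (proj₁ (all-hit c₁))    ≡⟨ cong g same-preimage ⟩
    g (proj₁ (all-hit c₂))    ≡⟨ proj₂ (all-hit c₂) ⟩
    c₂                        ∎))
  where open ≡-Reasoning

avoid-two : ∀ {m p} → 2 + m ≤ p → (g : Fin m → Fin p) →
            ∃₂ λ a a′ → a ≢ a′ × (∀ j → g j ≢ a) × (∀ j → g j ≢ a′)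
avoid-two {m} 2+m≤p g =
  let (a , a-free) = avoid (<-trans (n<1+n m) 2+m≤p) g
      (a′ , a′-free) = avoid 2+m≤p (a Vector.∷ g)
  in a , a′ , a′-free zero , a-free , a′-free ∘ suc


module ℤₚ (p′ : ℕ) (p-prime : Prime (suc p′)) where
  p : ℕ
  p = suc p′

  open GroupOps (Zmod p) renaming (_⊕_ to infixl 6 _⊕_; ⊖_ to infix 8 ⊖_)
  open ℤmod-arithmetic p
  open Flows (Zmod p) (ℤmod-isAbelian p) public
  open AbelianGroup (asAbelianGroup (Zmod p) (ℤmod-isAbelian p)) using (rawMonoid; group; comm; identityˡ; identityʳ)
  open import Algebra.Properties.Group group using (//-rightDividesˡ; //-rightDividesʳ)
  open import Algebra.Definitions.RawMonoid rawMonoid using () renaming (_×_ to _·_)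

  toℕ-· : ∀ k d → toℕ (k · d) ≡ (k * toℕ d) % p
  toℕ-· zero d = refl
  toℕ-· (suc k) d = begin
    toℕ (d ⊕ k · d)                ≡⟨ toℕ-⊕ d (k · d) ⟩
    (toℕ d + toℕ (k · d)) % p      ≡⟨ cong (λ r → (toℕ d + r) % p) (toℕ-· k d) ⟩
    (toℕ d + (k * toℕ d) % p) % p  ≡⟨ %-absorbʳ (toℕ d) (k * toℕ d) ⟩
    (suc k * toℕ d) % p            ∎
    where open ≡-Reasoning

  -- Bézout gives an inverse of toℕ d modulo p, up to sign.
  multiples-cover : ∀ {d} → d ≢ 0# → ∀ c → ∃ λ k → k · d ≡ c
  multiples-cover {d} d≢0 c with coprime-Bézout (prime⇒coprime p-prime {{≢-nonZero D≢0}} (toℕ<n d))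
    where D≢0 : toℕ d ≢ 0
          D≢0 D≡0 = d≢0 (toℕ-injective D≡0)
  ... | Bézout.-+ x y eq = toℕ c * y , toℕ-injective (begin
    toℕ ((toℕ c * y) · d)          ≡⟨ toℕ-· (toℕ c * y) d ⟩
    (toℕ c * y * toℕ d) % p        ≡⟨ cong (_% p) (*-assoc (toℕ c) y (toℕ d)) ⟩
    (toℕ c * (y * toℕ d)) % p      ≡⟨ cong (λ r → (toℕ c * r) % p) (sym eq) ⟩
    (toℕ c * (1 + x * p)) % p      ≡⟨ cong (_% p) (expand (toℕ c) x p) ⟩
    (toℕ c + toℕ c * x * p) % p    ≡⟨ [m+kn]%n≡m%n (toℕ c) (toℕ c * x) p ⟩
    toℕ c % p                      ≡⟨ m<n⇒m%n≡m (toℕ<n c) ⟩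
    toℕ c                          ∎)
    where open ≡-Reasoning
          expand : ∀ a b e → a * (1 + b * e) ≡ a + a * b * e
          expand = solve-∀
  ... | Bézout.+- x y eq = toℕ c * p′ * y , toℕ-injective (begin
    toℕ ((toℕ c * p′ * y) · d)                 ≡⟨ toℕ-· (toℕ c * p′ * y) d ⟩
    (k * toℕ d) % p                            ≡⟨ [m+kn]%n≡m%n (k * toℕ d) (toℕ c) p ⟨
    (k * toℕ d + toℕ c * p) % p                ≡⟨ cong (_% p) (regroup₁ (toℕ c) p′ y (toℕ d)) ⟩
    (toℕ c * p′ * (1 + y * toℕ d) + toℕ c) % p ≡⟨ cong (λ r → (toℕ c * p′ * r + toℕ c) % p) eq ⟩
    (toℕ c * p′ * (x * p) + toℕ c) % p         ≡⟨ cong (_% p) (regroup₂ (toℕ c) p′ x) ⟩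
    (toℕ c + toℕ c * p′ * x * p) % p           ≡⟨ [m+kn]%n≡m%n (toℕ c) (toℕ c * p′ * x) p ⟩
    toℕ c % p                                  ≡⟨ m<n⇒m%n≡m (toℕ<n c) ⟩
    toℕ c                                      ∎)
    where open ≡-Reasoning
          k = toℕ c * p′ * y
          regroup₁ : ∀ a b e f → a * b * e * f + a * suc b ≡ a * b * (1 + e * f) + a
          regroup₁ = solve-∀
          regroup₂ : ∀ a b e → a * b * (e * suc b) + a ≡ a + a * b * e * suc b
          regroup₂ = solve-∀

  _+ₛ_ : Subset p → Carrier → Subset p
  S +ₛ a = Vec.tabulate (λ c → Vec.lookup S (c ⊕ ⊖ a))

  ∈-+ₛ⁺ : ∀ {S c} a → c ∈ S → c ⊕ a ∈ S +ₛ a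
  ∈-+ₛ⁺ {S} {c} a c∈S = lookup⇒[]= _ _ (begin
    Vec.lookup (S +ₛ a) (c ⊕ a)   ≡⟨ lookup∘tabulate (λ c → Vec.lookup S (c ⊕ ⊖ a)) (c ⊕ a) ⟩
    Vec.lookup S (c ⊕ a ⊕ ⊖ a)    ≡⟨ cong (Vec.lookup S) (//-rightDividesʳ a c) ⟩
    Vec.lookup S c                ≡⟨ []=⇒lookup c∈S ⟩
    _                             ∎)
    where open ≡-Reasoning

  ∈-+ₛ⁻ : ∀ {S c} a → c ∈ S +ₛ a → c ⊕ ⊖ a ∈ S
  ∈-+ₛ⁻ {S} {c} a c∈S+a =
    lookup⇒[]= _ _ (trans (sym (lookup∘tabulate (λ c → Vec.lookup S (c ⊕ ⊖ a)) c)) ([]=⇒lookup c∈S+a))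

  closed⇒full : ∀ {S d} → 0# ∈ S → d ≢ 0# → (∀ c → c ∈ S → c ⊕ d ∈ S) → ∀ c → c ∈ S
  closed⇒full {S} {d} 0∈S d≢0 closed c =
    let (k , k·d≡c) = multiples-cover d≢0 c in subst (_∈ S) k·d≡c (multiples∈S k)
    where
    multiples∈S : ∀ k → k · d ∈ S
    multiples∈S zero = 0∈S
    multiples∈S (suc k) = subst (_∈ S) (comm (k · d) d) (closed _ (multiples∈S k))

  escape : ∀ {S d} → 0# ∈ S → d ≢ 0# → (∀ c → c ∈ S) ⊎ ∃ λ c → c ∈ S × c ⊕ d ∉ S
  escape {S} {d} 0∈S d≢0 with all? (λ c → c ∈? S →-dec (c ⊕ d) ∈? S)
  ... | yes closed = inj₁ (closed⇒full 0∈S d≢0 closed)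
  ... | no ¬closed with ¬∀⟶∃¬ p _ (λ c → c ∈? S →-dec (c ⊕ d) ∈? S) ¬closed
  ...   | c , ¬step with c ∈? S | (c ⊕ d) ∈? S
  ...     | yes c∈S | no c+d∉S = inj₂ (c , c∈S , c+d∉S)
  ...     | _       | yes c+d∈S = ⊥-elim (¬step (λ _ → c+d∈S))
  ...     | no c∉S  | _         = ⊥-elim (¬step (λ c∈S → ⊥-elim (c∉S c∈S)))

  subsetSums : ∀ {n} → (Fin n → Carrier) → Subset p
  subsetSums {zero} d = ⁅ 0# ⁆
  subsetSums {suc n} d = subsetSums (d ∘ suc) ∪ subsetSums (d ∘ suc) +ₛ d zero

  0∈subsetSums : ∀ {n} (d : Fin n → Carrier) → 0# ∈ subsetSums d
  0∈subsetSums {zero} d = x∈⁅x⁆ 0#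
  0∈subsetSums {suc n} d = p⊆p∪q _ (0∈subsetSums (d ∘ suc))

  selectedSum : ∀ {n} → (Fin n → Bool) → (Fin n → Carrier) → Carrier
  selectedSum ε d = sum (λ i → if ε i then d i else 0#)

  subsetSums-sound : ∀ {n} (d : Fin n → Carrier) {c} → c ∈ subsetSums d → ∃ λ ε → selectedSum ε d ≡ c
  subsetSums-sound {zero} d c∈⁅0⁆ = (λ ()) , sym (x∈⁅y⁆⇒x≡y 0# c∈⁅0⁆)
  subsetSums-sound {suc n} d {c} c∈sums with x∈p∪q⁻ (subsetSums (d ∘ suc)) _ c∈sums
  ... | inj₁ c∈S = let (ε , Σ≡c) = subsetSums-sound (d ∘ suc) c∈S in
    false Vector.∷ ε , trans (identityˡ _) Σ≡c
  ... | inj₂ c∈S+d₀ = let (ε , Σ≡c-d₀) = subsetSums-sound (d ∘ suc) (∈-+ₛ⁻ (d zero) c∈S+d₀) in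
    true Vector.∷ ε ,
    trans (cong (d zero ⊕_) Σ≡c-d₀) (trans (comm (d zero) (c ⊕ ⊖ d zero)) (//-rightDividesˡ (d zero) c))

  subsetSums-grow : ∀ {n} (d : Fin n → Carrier) → (∀ i → d i ≢ 0#) →
                    (∀ c → c ∈ subsetSums d) ⊎ suc n ≤ ∣ subsetSums d ∣
  subsetSums-grow {zero} d _ = inj₂ (≤-reflexive (sym (∣⁅x⁆∣≡1 0#)))
  subsetSums-grow {suc n} d d≢0
    with subsetSums-grow (d ∘ suc) (d≢0 ∘ suc) | escape (0∈subsetSums (d ∘ suc)) (d≢0 zero)
  ... | inj₁ all | _ = inj₁ (λ c → p⊆p∪q _ (all c))
  ... | inj₂ _ | inj₁ all = inj₁ (λ c → p⊆p∪q _ (all c))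
  ... | inj₂ large | inj₂ (c , c∈S , c+d₀∉S) = inj₂ (≤-trans (s≤s large) (p⊂q⇒∣p∣<∣q∣ S⊂S∪S+d₀))
    where S = subsetSums (d ∘ suc)
          S⊂S∪S+d₀ : S ⊂ S ∪ S +ₛ d zero
          S⊂S∪S+d₀ = p⊆p∪q _ , c ⊕ d zero , x∈p∪q⁺ (inj₂ (∈-+ₛ⁺ (d zero) c∈S)) , c+d₀∉S

  subset-sum : ∀ {n} (d : Fin n → Carrier) → (∀ i → d i ≢ 0#) → p ≤ suc n →
               ∀ c → ∃ λ ε → selectedSum ε d ≡ c
  subset-sum d d≢0 p≤1+n c = subsetSums-sound d (all-sums c)
    where
    all-sums : ∀ c → c ∈ subsetSums d
    all-sums with subsetSums-grow d d≢0
    ... | inj₁ all = all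
    ... | inj₂ large = λ c →
      subst (c ∈_) (sym (∣p∣≡n⇒p≡⊤ (≤-antisym (∣p∣≤n (subsetSums d)) (≤-trans p≤1+n large)))) ∈⊤

-- The theta graph

-- G_{q,m′+1} with edge (i, j) = combine i j running from vertex j to vertex j + 1 of path i, whose
-- vertices are s, inner i 0, …, inner i (m′ - 1), t.
module Θ-graph (q m′ : ℕ) where
  Vertex Edge : Set
  Vertex = Fin (2 + q * m′)
  Edge = Fin (q * suc m′)

  s t : Vertex
  s = zero
  t = suc zero

  inner : Fin q → Fin m′ → Vertex
  inner i j = suc (suc (combine i j))

  tailOnPath headOnPath : Fin q → Fin (suc m′) → Vertex
  tailOnPath i zero = s
  tailOnPath i (suc j) = inner i j
  headOnPath i j with view j
  ... | ‵fromℕ = t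
  ... | ‵inj₁ {i = j′} _ = inner i j′

  edge : Fin q → Fin (suc m′) → Edge
  edge = combine

  position : Edge → Fin q × Fin (suc m′)
  position = remQuot {q} (suc m′)

  ends : Edge → Vertex × Vertex
  ends x = tailOnPath (proj₁ (position x)) (proj₂ (position x)) , headOnPath (proj₁ (position x)) (proj₂ (position x))

  Θ : Multigraph
  Θ = graph ends

  data VertexView : Vertex → Set where
    source : VertexView s
    sink : VertexView t
    internal : ∀ i j → VertexView (inner i j)

  vertexView : ∀ v → VertexView v
  vertexView zero = source
  vertexView (suc zero) = sink
  vertexView (suc (suc u)) = subst (λ u → VertexView (suc (suc u))) (combine-remQuot {q} m′ u) (internal _ _)

  edge-position : ∀ x → edge (proj₁ (position x)) (proj₂ (position x)) ≡ x
  edge-position = combine-remQuot {q} (suc m′)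

  ends-edge : ∀ i j → ends (edge i j) ≡ (tailOnPath i j , headOnPath i j)
  ends-edge i j = cong (λ (i , j) → tailOnPath i j , headOnPath i j) (remQuot-combine i j)

  inner-injective : ∀ {i i′ j j′} → inner i j ≡ inner i′ j′ → i ≡ i′ × j ≡ j′
  inner-injective {i} {i′} {j} {j′} eq = combine-injectiveˡ i j i′ j′ c≡ , combine-injectiveʳ i j i′ j′ c≡
    where c≡ = suc-injective (suc-injective eq)

  headOnPath-inject₁ : ∀ i j → headOnPath i (inject₁ j) ≡ inner i j
  headOnPath-inject₁ i j rewrite view-inject₁ j = refl

  tailOnPath≡inner : ∀ {i i′} j {j′} → tailOnPath i j ≡ inner i′ j′ → i ≡ i′ × j ≡ suc j′
  tailOnPath≡inner (suc j) eq = map₂ (cong suc) (inner-injective eq)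

  headOnPath≡inner : ∀ {i i′} j {j′} → headOnPath i j ≡ inner i′ j′ → i ≡ i′ × j ≡ inject₁ j′
  headOnPath≡inner {i} j eq with view j
  ... | ‵inj₁ {i = j″} _ = map₂ (cong inject₁) (inner-injective eq)

  tailOnPath≡s : ∀ {i} j → tailOnPath i j ≡ s → j ≡ zero
  tailOnPath≡s zero _ = refl

  headOnPath≢s : ∀ {i} j → headOnPath i j ≢ s
  headOnPath≢s j eq with view j
  headOnPath≢s j () | ‵fromℕ
  headOnPath≢s j () | ‵inj₁ _

module Θ-boundary (Γ : GroupOps) (isAb : IsAbelian Γ) (q m′ : ℕ) where
  open GroupOps Γ renaming (_⊕_ to infixl 6 _⊕_; ⊖_ to infix 8 ⊖_)
  open Θ-graph q m′
  open Flows Γ isAb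
  open AbelianGroup (asAbelianGroup Γ isAb) using (identityʳ; group)
  open import Algebra.Properties.Group group using (ε⁻¹≈ε)

  forward : Edge → Bool
  forward _ = true

  private
    tails heads : Edge → Vertex
    tails = proj₁ ∘ ends
    heads = proj₂ ∘ ends

  tails≡inner : ∀ {x i j} → tails x ≡ inner i j → x ≡ edge i (suc j)
  tails≡inner {x} eq = let (i≡ , j≡) = tailOnPath≡inner (proj₂ (position x)) eq in
    trans (sym (edge-position x)) (cong₂ edge i≡ j≡)

  heads≡inner : ∀ {x i j} → heads x ≡ inner i j → x ≡ edge i (inject₁ j)
  heads≡inner {x} eq = let (i≡ , j≡) = headOnPath≡inner (proj₂ (position x)) eq in
    trans (sym (edge-position x)) (cong₂ edge i≡ j≡)

  netOut-inner : ∀ f i j → netOut Γ Θ forward f (inner i j) ≡ f (edge i (suc j)) ⊕ ⊖ f (edge i (inject₁ j))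
  netOut-inner f i j = trans (netOut≡ Θ forward f (inner i j)) (cong₂ (λ a b → a ⊕ ⊖ b)
    (sum-δ-unique tails (inner i j) f (edge i (suc j)) (cong proj₁ (ends-edge i (suc j))) (λ _ → tails≡inner))
    (sum-δ-unique heads (inner i j) f (edge i (inject₁ j))
      (trans (cong proj₂ (ends-edge i (inject₁ j))) (headOnPath-inject₁ i j)) (λ _ → heads≡inner)))

  netOut-source : ∀ f → netOut Γ Θ forward f s ≡ sum (λ i → f (edge i zero))
  netOut-source f = begin
    netOut Γ Θ forward f s                                         ≡⟨ netOut≡ Θ forward f s ⟩
    sum (λ x → δ (tails x) s (f x)) ⊕ ⊖ sum (λ x → δ (heads x) s (f x))
      ≡⟨ cong₂ (λ a b → a ⊕ ⊖ b) (sum-combine {q} _)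
               (sum-δ-none heads s f (λ x → headOnPath≢s (proj₂ (position x)))) ⟩
    sum (λ i → sum (λ j → δ (tails (edge i j)) s (f (edge i j)))) ⊕ ⊖ 0#
      ≡⟨ cong₂ (λ a b → a ⊕ b) (sum-cong-≗ leaving-path) ε⁻¹≈ε ⟩
    sum (λ i → f (edge i zero)) ⊕ 0#                                ≡⟨ identityʳ _ ⟩
    sum (λ i → f (edge i zero))                                     ∎
    where
    open ≡-Reasoning
    leaving-path : ∀ i → sum (λ j → δ (tails (edge i j)) s (f (edge i j))) ≡ f (edge i zero)
    leaving-path i = sum-δ-unique (tails ∘ edge i) s (f ∘ edge i) zero (cong proj₁ (ends-edge i zero))
      (λ j eq → tailOnPath≡s j (trans (sym (cong proj₁ (ends-edge i j))) eq))

-- G q m is the theta graph up to relabelling of edges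

listGraph : {n : ℕ} → List.List (Fin n × Fin n) → Multigraph
listGraph l = graph (List.lookup l)

applyUpTo≡tabulate : ∀ {A : Set} (f : ℕ → A) n → List.applyUpTo f n ≡ List.tabulate {n = n} (f ∘ toℕ)
applyUpTo≡tabulate f zero = refl
applyUpTo≡tabulate f (suc n) = cong (f 0 List.∷_) (applyUpTo≡tabulate (f ∘ suc) n)

tabulate-↑ : ∀ {A : Set} {m n} (g : Fin (m + n) → A) →
             List.tabulate g ≡ List.tabulate (g ∘ (_↑ˡ n)) List.++ List.tabulate (g ∘ (m ↑ʳ_))
tabulate-↑ {m = zero} g = refl
tabulate-↑ {m = suc m} g = cong (g zero List.∷_) (tabulate-↑ {m = m} (g ∘ suc))

concat-tabulate : ∀ {A : Set} {q m} (r : Fin q → Fin m → A) (g : Fin (q * m) → A) →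
                  (∀ i j → r i j ≡ g (combine i j)) →
                  List.concat (List.tabulate (List.tabulate ∘ r)) ≡ List.tabulate g
concat-tabulate {q = zero} r g r≡g = refl
concat-tabulate {q = suc q} {m} r g r≡g = begin
  List.tabulate (r zero) List.++ List.concat (List.tabulate (List.tabulate ∘ r ∘ suc))
    ≡⟨ cong₂ List._++_ (Listₚ.tabulate-cong (r≡g zero))
                       (concat-tabulate (r ∘ suc) (g ∘ (m ↑ʳ_)) (r≡g ∘ suc)) ⟩
  List.tabulate (g ∘ (_↑ˡ (q * m))) List.++ List.tabulate (g ∘ (m ↑ʳ_))
    ≡⟨ tabulate-↑ {m = m} g ⟨
  List.tabulate g ∎
  where open ≡-Reasoning

module _ (Γ : GroupOps) (isAb : IsAbelian Γ) {n e : ℕ} (g : Fin e → Fin n × Fin n) where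
  open Flows Γ isAb using (relabel)

  private
    π : Fin e ↔ Fin (List.length (List.tabulate g))
    π = mk↔ₛ′ (cast (sym (Listₚ.length-tabulate g))) (cast (Listₚ.length-tabulate g))
              (cast-involutive (sym (Listₚ.length-tabulate g)) (Listₚ.length-tabulate g))
              (cast-involutive (Listₚ.length-tabulate g) (sym (Listₚ.length-tabulate g)))

  tabulate-connected : IsConnected Γ (graph g) → IsConnected Γ (listGraph (List.tabulate g))
  tabulate-connected = relabel π (Listₚ.lookup-tabulate g)

  tabulate-connected⁻ : IsConnected Γ (listGraph (List.tabulate g)) → IsConnected Γ (graph g)
  tabulate-connected⁻ = relabel (↔-sym π) λ x →
    trans (sym (Listₚ.lookup-tabulate g (Inverse.from π x)))
          (cong (List.lookup (List.tabulate g)) (Inverse.strictlyInverseˡ π x))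

module Θ≅G (q m′ : ℕ) where
  open Θ-graph q m′

  N : ℕ
  N = 2 + q * m′

  -- The vertex numbering used by G in Defs, where it is private.
  pathNode : ℕ → ℕ → ℕ
  pathNode i zero = 0
  pathNode i (suc j) = if does (suc j ℕ.≟ suc m′) then 1 else 2 + i * m′ + j

  pathEnds : ℕ → ℕ → Vertex × Vertex
  pathEnds i j = pathNode i j mod N , pathNode i (suc j) mod N

  rows : (ℕ → ℕ → Vertex × Vertex) → List.List (Vertex × Vertex)
  rows P = List.concatMap (λ i → List.map (P i) (List.upTo (suc m′))) (List.upTo q)

  rows-cong : {P : ℕ → ℕ → Vertex × Vertex} → (∀ i j → P i j ≡ pathEnds i j) →
              listGraph (rows P) ≡ listGraph (rows pathEnds)
  rows-cong P≡ =
    cong listGraph (Listₚ.concatMap-cong (λ i → Listₚ.map-cong (P≡ i) (List.upTo (suc m′))) (List.upTo q))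

  G≡rows : G q (suc m′) ≡ listGraph (rows pathEnds)
  G≡rows = rows-cong λ { i zero → refl ; i (suc j) → refl }

  mod-toℕ : (w : Vertex) → toℕ w mod N ≡ w
  mod-toℕ w = toℕ-injective (trans (toℕ-fromℕ< _) (m<n⇒m%n≡m (toℕ<n w)))

  pathNode-inner : ∀ i (j : Fin m′) → pathNode (toℕ i) (suc (toℕ j)) mod N ≡ inner i j
  pathNode-inner i j = begin
    pathNode (toℕ i) (suc (toℕ j)) mod N
      ≡⟨ cong (λ b → (if b then 1 else 2 + toℕ i * m′ + toℕ j) mod N)
              (dec-false (suc (toℕ j) ℕ.≟ suc m′) (<⇒≢ (s≤s (toℕ<n j)))) ⟩
    (2 + toℕ i * m′ + toℕ j) mod N
      ≡⟨ cong (λ k → (2 + k) mod N) (trans (cong (_+ toℕ j) (*-comm (toℕ i) m′)) (sym (toℕ-combine i j))) ⟩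
    toℕ (inner i j) mod N
      ≡⟨ mod-toℕ (inner i j) ⟩
    inner i j ∎
    where open ≡-Reasoning

  pathNode-last : ∀ i → pathNode i (suc m′) mod N ≡ t
  pathNode-last i = cong (λ b → (if b then 1 else 2 + i * m′ + m′) mod N) (dec-true (suc m′ ℕ.≟ suc m′) refl)

  pathEnds≡ends : ∀ i j → pathEnds (toℕ i) (toℕ j) ≡ ends (edge i j)
  pathEnds≡ends i j = trans (cong₂ _,_ (tail≡ j) (head≡ j)) (sym (ends-edge i j))
    where
    tail≡ : ∀ j → pathNode (toℕ i) (toℕ j) mod N ≡ tailOnPath i j
    tail≡ zero = refl
    tail≡ (suc j) = pathNode-inner i j
    head≡ : ∀ j → pathNode (toℕ i) (suc (toℕ j)) mod N ≡ headOnPath i j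
    head≡ j with view j
    ... | ‵fromℕ rewrite toℕ-fromℕ m′ = pathNode-last (toℕ i)
    ... | ‵inj₁ {i = j′} _ rewrite toℕ-inject₁ j′ = pathNode-inner i j′

  rows≡tabulate : rows pathEnds ≡ List.tabulate ends
  rows≡tabulate = begin
    List.concat (List.map row (List.upTo q))
      ≡⟨ cong (List.concat ∘ List.map row) (applyUpTo≡tabulate (λ i → i) q) ⟩
    List.concat (List.map row (List.tabulate {n = q} toℕ))
      ≡⟨ cong List.concat (Listₚ.map-tabulate {n = q} toℕ row) ⟩
    List.concat (List.tabulate {n = q} (row ∘ toℕ))        ≡⟨ cong List.concat (Listₚ.tabulate-cong row-tabulate) ⟩
    List.concat (List.tabulate (λ (i : Fin q) → List.tabulate (λ (j : Fin (suc m′)) → pathEnds (toℕ i) (toℕ j))))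
                                                     ≡⟨ concat-tabulate _ ends pathEnds≡ends ⟩
    List.tabulate ends                                  ∎
    where
    open ≡-Reasoning
    row : ℕ → List.List (Vertex × Vertex)
    row i = List.map (pathEnds i) (List.upTo (suc m′))
    row-tabulate : ∀ (i : Fin q) → row (toℕ i) ≡ List.tabulate (λ (j : Fin (suc m′)) → pathEnds (toℕ i) (toℕ j))
    row-tabulate i = trans (cong (List.map (pathEnds (toℕ i))) (applyUpTo≡tabulate (λ j → j) (suc m′)))
                           (Listₚ.map-tabulate toℕ (pathEnds (toℕ i)))

  module _ (Γ : GroupOps) (isAb : IsAbelian Γ) where
    G⇒Θ : IsConnected Γ (G q (suc m′)) → IsConnected Γ Θ
    G⇒Θ = tabulate-connected⁻ Γ isAb ends ∘ subst (IsConnected Γ) (trans G≡rows (cong listGraph rows≡tabulate))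

    Θ⇒G : IsConnected Γ Θ → IsConnected Γ (G q (suc m′))
    Θ⇒G = subst (IsConnected Γ) (sym (trans G≡rows (cong listGraph rows≡tabulate))) ∘ tabulate-connected Γ isAb ends

-- No ℤ₂ᵏ-connectivity for odd q

binaryDigits : ∀ {n} → Fin (2 ^ n) → Vec Bool n
binaryDigits j = Vec.tabulate (Inverse.to 2↔Bool ∘ finToFun j)

binaryDigits-onto : ∀ {n} (w : Vec Bool n) → ∃ λ j → binaryDigits j ≡ w
binaryDigits-onto w = funToFin (Inverse.from 2↔Bool ∘ Vec.lookup w) , (begin
  Vec.tabulate (Inverse.to 2↔Bool ∘ finToFun (funToFin (Inverse.from 2↔Bool ∘ Vec.lookup w)))
    ≡⟨ tabulate-cong (λ l → cong (Inverse.to 2↔Bool) (finToFun-funToFin _ l)) ⟩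
  Vec.tabulate (Inverse.to 2↔Bool ∘ Inverse.from 2↔Bool ∘ Vec.lookup w)
    ≡⟨ tabulate-cong (λ l → Inverse.strictlyInverseˡ 2↔Bool (Vec.lookup w l)) ⟩
  Vec.tabulate (Vec.lookup w)
    ≡⟨ tabulate∘lookup w ⟩
  w ∎)
  where open ≡-Reasoning

xor-copies : ℕ → Bool
xor-copies zero = false
xor-copies (suc q) = not (xor-copies q)

xor-copies-even : ∀ q → xor-copies q ≡ false → 2 ∣ q
xor-copies-even zero _ = divides 0 refl
xor-copies-even (suc zero) ()
xor-copies-even (suc (suc q)) eq = ∣m∣n⇒∣m+n ∣-refl (xor-copies-even q (trans (sym (not-involutive _)) eq))

module Z₂-obstruction (n q m′ : ℕ) (enum : Fin (suc m′) → Vec Bool n) (enum-onto : ∀ w → ∃ λ j → enum j ≡ w)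
  where
  Γ : GroupOps
  Γ = Z2^ (suc n)
  open GroupOps Γ renaming (_⊕_ to infixl 6 _⊕_)
  open Θ-graph q m′
  open Θ-boundary Γ (ℤ₂^-isAbelian (suc n)) q m′
  open Flows Γ (ℤ₂^-isAbelian (suc n))
  open AbelianGroup (asAbelianGroup Γ (ℤ₂^-isAbelian (suc n))) using (assoc; comm; identityˡ; identityʳ)

  -- β forces f (edge i j) = offset i ⊕ label j on every solution (along-path), and the labels exhaust
  -- the elements with first bit false.
  label : Fin (suc m′) → Carrier
  label j = false ∷ enum j

  demand : Fin (q * m′) → Carrier
  demand u = label (inject₁ j) ⊕ label (suc j)
    where j = proj₂ (remQuot {q} m′ u)

  β : Vertex → Carrier
  β zero = 0#
  β (suc zero) = sumFin Γ demand
  β (suc (suc u)) = demand u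

  β-inner : ∀ i j → β (inner i j) ≡ label (inject₁ j) ⊕ label (suc j)
  β-inner i j = cong (λ (_ , j) → label (inject₁ j) ⊕ label (suc j)) (remQuot-combine i j)

  Σβ≡0 : sumFin Γ β ≡ 0#
  Σβ≡0 = trans (identityˡ _) (ℤ₂^-self (sumFin Γ demand))

  ⊕-solve : ∀ {a b c} → a ⊕ b ≡ c → a ≡ c ⊕ b
  ⊕-solve {a} {b} refl = sym (trans (assoc a b b) (trans (cong (a ⊕_) (ℤ₂^-self b)) (identityʳ a)))

  ⊕-rearrange : ∀ p r x → (p ⊕ r) ⊕ (x ⊕ p) ≡ x ⊕ r
  ⊕-rearrange p r x = begin
    (p ⊕ r) ⊕ (x ⊕ p)  ≡⟨ comm (p ⊕ r) (x ⊕ p) ⟩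
    (x ⊕ p) ⊕ (p ⊕ r)  ≡⟨ assoc x p (p ⊕ r) ⟩
    x ⊕ (p ⊕ (p ⊕ r))  ≡⟨ cong (x ⊕_) (assoc p p r) ⟨
    x ⊕ (p ⊕ p ⊕ r)    ≡⟨ cong (λ z → x ⊕ (z ⊕ r)) (ℤ₂^-self p) ⟩
    x ⊕ (0# ⊕ r)       ≡⟨ cong (x ⊕_) (identityˡ r) ⟩
    x ⊕ r              ∎
    where open ≡-Reasoning

  head-⊕ : ∀ (a b : Carrier) → Vec.head (a ⊕ b) ≡ Vec.head a xor Vec.head b
  head-⊕ (x ∷ a) (y ∷ b) = refl

  head-sum : ∀ {r} (g : Fin r → Carrier) → (∀ i → Vec.head (g i) ≡ true) → Vec.head (sum g) ≡ xor-copies r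
  head-sum {zero} g _ = refl
  head-sum {suc r} g odd = trans (head-⊕ (g zero) _) (cong₂ _xor_ (odd zero) (head-sum (g ∘ suc) (odd ∘ suc)))

  module _ (o : Edge → Bool) (f : Edge → Carrier) (nowhere-zero : ∀ x → ¬ f x ≡ 0#)
           (boundary : ∀ v → netOut Γ Θ o f v ≡ β v) where

    forward-boundary : ∀ v → netOut Γ Θ forward f v ≡ β v
    forward-boundary v = trans (netOut-orientation-irrelevant Θ (λ _ → refl) forward o f v) (boundary v)

    offset : Fin q → Carrier
    offset i = f (edge i zero) ⊕ label zero

    along-path : ∀ i j → f (edge i j) ≡ offset i ⊕ label j
    along-path i = <-weakInduction (λ j → f (edge i j) ≡ offset i ⊕ label j) (⊕-solve refl) λ j ih → begin
      f (edge i (suc j))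
        ≡⟨ ⊕-solve (trans (sym (netOut-inner f i j)) (trans (forward-boundary _) (β-inner i j))) ⟩
      (label (inject₁ j) ⊕ label (suc j)) ⊕ f (edge i (inject₁ j))
        ≡⟨ cong (label (inject₁ j) ⊕ label (suc j) ⊕_) ih ⟩
      (label (inject₁ j) ⊕ label (suc j)) ⊕ (offset i ⊕ label (inject₁ j))
        ≡⟨ ⊕-rearrange _ _ _ ⟩
      offset i ⊕ label (suc j)                                ∎
      where open ≡-Reasoning

    offset-odd : ∀ i → Vec.head (offset i) ≡ true
    offset-odd i with offset i in eq
    ... | true ∷ _ = refl
    ... | false ∷ w = ⊥-elim (nowhere-zero (edge i j) (begin
      f (edge i j)               ≡⟨ along-path i j ⟩
      offset i ⊕ label j         ≡⟨ cong₂ _⊕_ eq (cong (false ∷_) enum-j) ⟩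
      (false ∷ w) ⊕ (false ∷ w)  ≡⟨ ℤ₂^-self (false ∷ w) ⟩
      0#                         ∎))
      where open ≡-Reasoning
            j = proj₁ (enum-onto w)
            enum-j = proj₂ (enum-onto w)

    first-edge-odd : ∀ i → Vec.head (f (edge i zero)) ≡ true
    first-edge-odd i = begin
      Vec.head (f (edge i zero))                 ≡⟨ cong Vec.head (along-path i zero) ⟩
      Vec.head (offset i ⊕ label zero)           ≡⟨ head-⊕ (offset i) (label zero) ⟩
      Vec.head (offset i) xor false              ≡⟨ cong (_xor false) (offset-odd i) ⟩
      true                                       ∎
      where open ≡-Reasoning

    q-even : 2 ∣ q
    q-even = xor-copies-even q (begin
      xor-copies q                               ≡⟨ head-sum (λ i → f (edge i zero)) first-edge-odd ⟨
      Vec.head (sum (λ i → f (edge i zero)))     ≡⟨ cong Vec.head (trans (sym (netOut-source f)) (forward-boundary s)) ⟩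
      Vec.head 0#                                ∎)
      where open ≡-Reasoning

  not-connected : ¬ 2 ∣ q → ¬ IsConnected Γ Θ
  not-connected odd (o , solve) =
    let (f , nowhere-zero , boundary) = solve β Σβ≡0 in odd (q-even o f nowhere-zero boundary)

-- ℤₚ-connectivity for q ≥ p

module ℤₚ-connectivity (p′ : ℕ) (p-prime : Prime (suc p′)) (q m′ : ℕ)
                        (short-paths : 2 + suc m′ ≤ suc p′) (many-paths : suc p′ ≤ q) where
  open ℤₚ p′ p-prime
  open GroupOps (Zmod p) renaming (_⊕_ to infixl 6 _⊕_; ⊖_ to infix 8 ⊖_)
  open Θ-graph q m′
  open Θ-boundary (Zmod p) (ℤmod-isAbelian p) q m′
  open AbelianGroup (asAbelianGroup (Zmod p) (ℤmod-isAbelian p)) using (group; comm; assoc; identityʳ; inverseʳ)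
  open import Algebra.Properties.Group group using (inverseˡ-unique; x∙y⁻¹≈ε⇒x≈y; //-rightDividesˡ)
  open import Algebra.Properties.AbelianGroup (asAbelianGroup (Zmod p) (ℤmod-isAbelian p)) using (xyx⁻¹≈y)

  if-avoids : ∀ b {x y z : Carrier} → z ≢ x → z ≢ y → z ≢ (if b then y else x)
  if-avoids true _ z≢y = z≢y
  if-avoids false z≢x _ = z≢x

  if-as-offset : ∀ b x y → (if b then y else x) ≡ x ⊕ (if b then y ⊕ ⊖ x else 0#)
  if-as-offset true x y = sym (trans (comm x (y ⊕ ⊖ x)) (//-rightDividesˡ x y))
  if-as-offset false x y = sym (identityʳ x)

  module _ (β : Vertex → Carrier) where
    potential : Fin q → Fin (suc m′) → Carrier
    potential i = prefixSum (β ∘ inner i)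

    StartValues : Set
    StartValues = ∃ λ start → (∀ i j → ⊖ potential i j ≢ start i) × sum start ≡ β s

    start-from-choice : (low high : Fin q → Carrier) →
                        (∀ i j → ⊖ potential i j ≢ low i) → (∀ i j → ⊖ potential i j ≢ high i) →
                        (choice : Fin q → Bool) →
                        selectedSum choice (λ i → high i ⊕ ⊖ low i) ≡ β s ⊕ ⊖ sum low →
                        StartValues
    start-from-choice low high low-free high-free choice selection = start , start-avoids , sum-start
      where
      start : Fin q → Carrier
      start i = if choice i then high i else low i
      start-avoids : ∀ i j → ⊖ potential i j ≢ start i
      start-avoids i j = if-avoids (choice i) (low-free i j) (high-free i j)
      sum-start : sum start ≡ β s
      sum-start = begin
        sum start                                              ≡⟨ sum-cong-≗ (λ i → if-as-offset (choice i) (low i) (high i)) ⟩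
        sum (λ i → low i ⊕ (if choice i then high i ⊕ ⊖ low i else 0#))
          ≡⟨ ∑-distrib-+ low (λ i → if choice i then high i ⊕ ⊖ low i else 0#) ⟩
        sum low ⊕ selectedSum choice (λ i → high i ⊕ ⊖ low i) ≡⟨ cong (sum low ⊕_) selection ⟩
        sum low ⊕ (β s ⊕ ⊖ sum low)                            ≡⟨ comm (sum low) (β s ⊕ ⊖ sum low) ⟩
        β s ⊕ ⊖ sum low ⊕ sum low                              ≡⟨ //-rightDividesˡ (sum low) (β s) ⟩
        β s                                                    ∎
        where open ≡-Reasoning

    -- Each start value must avoid the m′ + 1 values ⊖ potential i j (flow≢0): two candidates remain on
    -- every path, and a subset sum of their differences chooses between them.
    start-values : StartValues
    start-values = start-from-choice low high low-free high-free (proj₁ selection) (proj₂ selection)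
      where
      choices = λ i → avoid-two short-paths (⊖_ ∘ potential i)
      low high : Fin q → Carrier
      low i = proj₁ (choices i)
      high i = proj₁ (proj₂ (choices i))
      low-free : ∀ i j → ⊖ potential i j ≢ low i
      low-free i = proj₁ (proj₂ (proj₂ (proj₂ (choices i))))
      high-free : ∀ i j → ⊖ potential i j ≢ high i
      high-free i = proj₂ (proj₂ (proj₂ (proj₂ (choices i))))
      step≢0 : ∀ i → high i ⊕ ⊖ low i ≢ 0#
      step≢0 i step≡0 = proj₁ (proj₂ (proj₂ (choices i))) (sym (x∙y⁻¹≈ε⇒x≈y (high i) (low i) step≡0))
      selection = subset-sum (λ i → high i ⊕ ⊖ low i) step≢0 (≤-trans many-paths (n≤1+n q)) (β s ⊕ ⊖ sum low)

    module _ (start : Fin q → Carrier) (start-avoids : ∀ i j → ⊖ potential i j ≢ start i) where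
      flow : Edge → Carrier
      flow x = start i ⊕ potential i j
        where i = proj₁ (position x)
              j = proj₂ (position x)

      flow-edge : ∀ i j → flow (edge i j) ≡ start i ⊕ potential i j
      flow-edge i j = cong (λ (i , j) → start i ⊕ potential i j) (remQuot-combine i j)

      flow≢0 : ∀ x → flow x ≢ 0#
      flow≢0 x flow≡0 = start-avoids i j (sym (inverseˡ-unique (start i) (potential i j) flow≡0))
        where i = proj₁ (position x)
              j = proj₂ (position x)

      boundary-inner : ∀ i j → netOut (Zmod p) Θ forward flow (inner i j) ≡ β (inner i j)
      boundary-inner i j = begin
        netOut (Zmod p) Θ forward flow (inner i j)                 ≡⟨ netOut-inner flow i j ⟩
        flow (edge i (suc j)) ⊕ ⊖ flow (edge i (inject₁ j))
          ≡⟨ cong₂ (λ a b → a ⊕ ⊖ b) (flow-edge i (suc j)) (flow-edge i (inject₁ j)) ⟩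
        x ⊕ potential i (suc j) ⊕ ⊖ (x ⊕ u)
          ≡⟨ cong (λ a → x ⊕ a ⊕ ⊖ (x ⊕ u)) (prefixSum-suc (β ∘ inner i) j) ⟩
        x ⊕ (u ⊕ β (inner i j)) ⊕ ⊖ (x ⊕ u)                        ≡⟨ cong (_⊕ ⊖ (x ⊕ u)) (assoc x u _) ⟨
        x ⊕ u ⊕ β (inner i j) ⊕ ⊖ (x ⊕ u)                          ≡⟨ xyx⁻¹≈y (x ⊕ u) _ ⟩
        β (inner i j)                                              ∎
        where open ≡-Reasoning
              x = start i
              u = potential i (inject₁ j)

      module _ (sum-start : sum start ≡ β s) (Σβ≡0 : sum β ≡ 0#) where
        boundary-except-sink : ∀ {v} → VertexView v → v ≢ t → netOut (Zmod p) Θ forward flow v ≡ β v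
        boundary-except-sink sink t≢t = ⊥-elim (t≢t refl)
        boundary-except-sink (internal i j) _ = boundary-inner i j
        boundary-except-sink source _ = begin
          netOut (Zmod p) Θ forward flow s   ≡⟨ netOut-source flow ⟩
          sum (λ i → flow (edge i zero))      ≡⟨ sum-cong-≗ (λ i → trans (flow-edge i zero) (identityʳ (start i))) ⟩
          sum start                           ≡⟨ sum-start ⟩
          β s                                 ∎
          where open ≡-Reasoning

        boundary-sink : netOut (Zmod p) Θ forward flow t ≡ β t
        boundary-sink = agree-at-from-sum (netOut (Zmod p) Θ forward flow) β t
          (trans (netOut-total Θ forward flow) (sym Σβ≡0)) (λ w → boundary-except-sink (vertexView w))

        boundary-by-cases : ∀ v → Dec (v ≡ t) → netOut (Zmod p) Θ forward flow v ≡ β v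
        boundary-by-cases v (yes refl) = boundary-sink
        boundary-by-cases v (no v≢t) = boundary-except-sink (vertexView v) v≢t

        boundary : ∀ v → netOut (Zmod p) Θ forward flow v ≡ β v
        boundary v = boundary-by-cases v (v ≟ t)

  connected : IsConnected (Zmod p) Θ
  connected = forward , λ β Σβ≡0 →
    let (start , start-avoids , sum-start) = start-values β in
    flow β start start-avoids , flow≢0 β start start-avoids ,
    boundary β start start-avoids sum-start (trans (sym (sumFin≡sum β)) Σβ≡0)

positive⇒suc : ∀ {m} → 0 < m → ∃ λ m′ → m ≡ suc m′
positive⇒suc (s≤s _) = _ , refl

G-not-ℤ₂-connected : ∀ n q → ¬ 2 ∣ q → ¬ IsConnected (Z2^ (suc n)) (G q (2 ^ n))
G-not-ℤ₂-connected n q odd =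
  let (m′ , 2^n≡1+m′) = positive⇒suc (m^n>0 2 n)
      enum = binaryDigits ∘ cast (sym 2^n≡1+m′)
      enum-onto : ∀ w → ∃ λ j → enum j ≡ w
      enum-onto w = let (j , digits≡w) = binaryDigits-onto w in
        cast 2^n≡1+m′ j , trans (cong binaryDigits (cast-involutive (sym 2^n≡1+m′) 2^n≡1+m′ j)) digits≡w
  in subst (λ m → ¬ IsConnected (Z2^ (suc n)) (G q m)) (sym 2^n≡1+m′)
       (Z₂-obstruction.not-connected n q m′ enum enum-onto odd
        ∘ Θ≅G.G⇒Θ q m′ (Z2^ (suc n)) (ℤ₂^-isAbelian (suc n)))

G-ℤₚ-connected : ∀ p′ → Prime (suc p′) → ∀ n q → 2 ^ n + 1 < suc p′ → suc p′ ≤ q →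
                 IsConnected (Zmod (suc p′)) (G q (2 ^ n))
G-ℤₚ-connected p′ p-prime n q short p≤q =
  let (m′ , 2^n≡1+m′) = positive⇒suc (m^n>0 2 n) in
  subst (IsConnected (Zmod (suc p′)) ∘ G q) (sym 2^n≡1+m′)
    (Θ≅G.Θ⇒G q m′ (Zmod (suc p′)) (ℤmod-isAbelian (suc p′))
      (ℤₚ-connectivity.connected p′ p-prime q m′
        (subst (_< suc p′) (trans (cong (_+ 1) 2^n≡1+m′) (+-comm (suc m′) 1)) short) p≤q))

theorem2 : (k : ℕ) → 1 ≤ k → (p : ℕ) → (pp : Prime p) → 2 ^ (k ∸ 1) + 1 < p →
    ((r : ℕ) → Prime r → 2 ^ (k ∸ 1) + 1 < r → p ≤ r) →
    ((q : ℕ) → ¬ (2 ∣ q) → ¬ IsConnected (Z2^ k) (G q (2 ^ (k ∸ 1))))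
    × ((q : ℕ) → p ≤ q → IsConnected (Zmod p {{prime⇒nonZero pp}}) (G q (2 ^ (k ∸ 1))))
theorem2 (suc n) _ (suc p′) p-prime short _ = G-not-ℤ₂-connected n , λ q → G-ℤₚ-connected p′ p-prime n q short
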